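{- Let $G=(V,E)$ be a finite simple undirected graph and let $d_1,d_2$ be numbers. Consider a process that maintains a partition $(H,L)$ of $V$, starting with $H=V$ and $L=\emptyset$, and repeatedly moves single vertices from $H$ to $L$, such that the following conditions hold: (1) every vertex $v\in H$ with $d_H(v)<d_2$ is (eventually) moved to $L$, so that at the end of the process every $v\in H$ satisfies $d_H(v)\ge d_2$; (2) a vertex $v\in H$ is never moved to $L$ at a moment when $d_H(v)\ge d_1$. Then at the end of the process, every vertex in $H$ has core number at least $d_2$, and every vertex in $L$ has core number less than $d_1$.
   Context: For $S\subseteq V$ and $v\in V$, $d_S(v)$ denotes the number of neighbors of $v$ in $S$ (the degree of $v$ in the subgraph induced by $S$, evaluated at the current moment). A $k$-core of $G$ is a maximal connected induced subgraph in which every vertex has degree at least $k$; the core number of $v$ is the largest $k$ such that $v$ lies in a $k$-core. -}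

module Defs where

open import Data.Nat using (ℕ; _≤_; _<_)
open import Data.Nat.ListAction using (sum)
open import Data.Bool using (Bool; true; false; if_then_else_; _∧_)
open import Data.Fin using (Fin)
open import Data.Fin.Subset using (Subset; _∈_; _⊆_; ⊤; _-_)
open import Data.Vec using (lookup)
open import Data.List using (List; []; _∷_; allFin; map)
open import Data.Product using (Σ; _×_; ∃)
open import Relation.Binary.PropositionalEquality using (_≡_)

record Graph (n : ℕ) : Set where
  field
    adj     : Fin n → Fin n → Bool
    adj-sym : ∀ u v → adj u v ≡ adj v u
    adj-irr : ∀ v → adj v v ≡ false
open Graph public

module _ {n : ℕ} (G : Graph n) where

  deg : Subset n → Fin n → ℕ
  deg S v = sum (map (λ u → if lookup S u ∧ adj G u v then 1 else 0) (allFin n))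

  data Reach (S : Subset n) : Fin n → Fin n → Set where
    here : ∀ {u} → u ∈ S → Reach S u u
    step : ∀ {u w v} → u ∈ S → adj G u w ≡ true → Reach S w v → Reach S u v

  Connected : Subset n → Set
  Connected S = ∀ u v → u ∈ S → v ∈ S → Reach S u v

  MinDegAtLeast : ℕ → Subset n → Set
  MinDegAtLeast k S = ∀ v → v ∈ S → k ≤ deg S v

  IsKCore : ℕ → Subset n → Set
  IsKCore k S = Connected S × MinDegAtLeast k S
              × (∀ T → S ⊆ T → Connected T → MinDegAtLeast k T → T ⊆ S)

  InKCore : ℕ → Fin n → Set
  InKCore k v = ∃ λ S → IsKCore k S × v ∈ S

  IsCoreNumber : Fin n → ℕ → Set
  IsCoreNumber v c = InKCore c v × (∀ k → InKCore k v → k ≤ c)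

  -- The process: moving the vertices of a list one by one from H to L.
  -- Run d₁ H ms : every move of v happens while v ∈ H and d_H(v) < d₁
  -- (i.e. never at a moment when d_H(v) ≥ d₁).
  data Run (d₁ : ℕ) : Subset n → List (Fin n) → Set where
    done : ∀ {H} → Run d₁ H []
    move : ∀ {H v ms} → v ∈ H → deg H v < d₁ → Run d₁ (H - v) ms → Run d₁ H (v ∷ ms)

  finalH : Subset n → List (Fin n) → Subset n
  finalH H []       = H
  finalH H (v ∷ ms) = finalH (H - v) ms

-- A set S inducing minimum degree ≥ d₁ is never touched by the process: while S ⊆ H, every
-- vertex of S has d_H ≥ d_S ≥ d₁, so it cannot be moved.  Vertices of a k-core form such a set,
-- so a vertex of core number ≥ d₁ stays in H.  Conversely, the final H induces minimum degree
-- ≥ d₂.  Every set of minimum degree ≥ k lies in the greatest such set (obtained by peeling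
-- vertices of degree < k), and the connected components of that greatest set are exactly the
-- k-cores; hence every vertex of H lies in a d₂-core.  The core number exists because
-- membership in a k-core is decidable and bounded by k ≤ d_V(v).
module Submission where

open import Defs
open import Data.Nat using (ℕ; zero; suc; _≤_; _<_; z≤n; _∸_; _<?_)
open import Data.Nat.Properties using (≤-refl; ≤-trans; +-mono-≤; <⇒≱; ≮⇒≥; ≰⇒>; ≤-pred; ≤∧≢⇒<; ∸-monoʳ-<)
open import Data.Nat.Induction using (<-wellFounded)
open import Data.Nat.ListAction using (sum)
open import Data.Bool using (true; false; if_then_else_; _∧_)
open import Data.Bool.Properties using () renaming (_≟_ to _≟ᵇ_)
open import Data.Fin using (Fin)
open import Data.Fin.Properties using (any?)
open import Data.Fin.Subset using (Subset; _∈_; _∉_; ⊤; _⊆_; _-_; _∪_; ⁅_⁆; ∣_∣)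
open import Data.Fin.Subset.Properties using (_∈?_; ∈⊤; x∈p∧x≢y⇒x∈p-y; x∈p⇒∣p-x∣<∣p∣; ∣p∣≤n; p─q⊆p; p⊆p∪q; q⊆p∪q; x∈⁅x⁆; x∈⁅y⁆⇒x≡y; x∈p∪q⁻; p⊂q⇒∣p∣<∣q∣)
open import Data.Vec using (lookup)
open import Data.Vec.Properties using (lookup⇒[]=; []=⇒lookup)
open import Data.List using (List; []; _∷_; allFin; map)
open import Data.Product using (∃; _×_; _,_)
open import Data.Sum using (inj₁; inj₂; map₂)
open import Induction.WellFounded using (Acc; acc)
open import Relation.Nullary using (Dec; yes; no; ¬?; contradiction)
open import Relation.Nullary.Decidable using (_×-dec_)
open import Relation.Unary using (Decidable)
open import Relation.Binary.PropositionalEquality using (_≡_; refl; trans)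

sum-map-mono : ∀ {A : Set} {f g : A → ℕ} (xs : List A) → (∀ x → f x ≤ g x) →
               sum (map f xs) ≤ sum (map g xs)
sum-map-mono []       f≤g = z≤n
sum-map-mono (x ∷ xs) f≤g = +-mono-≤ (f≤g x) (sum-map-mono xs f≤g)

greatest-satisfying : ∀ {P : ℕ → Set} → Decidable P → P 0 → ∀ m → (∀ k → P k → k ≤ m) →
                      ∃ λ c → P c × (∀ k → P k → k ≤ c)
greatest-satisfying P? P0 m bounded with P? m
... | yes Pm = m , Pm , bounded
greatest-satisfying P? P0 zero    bounded | no ¬P0 = contradiction P0 ¬P0
greatest-satisfying P? P0 (suc m) bounded | no ¬Pm =
  greatest-satisfying P? P0 m λ k Pk → ≤-pred (≤∧≢⇒< (bounded k Pk) λ { refl → ¬Pm Pk })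

module _ {n : ℕ} (G : Graph n) where

  deg-mono : ∀ {S T} v → (∀ {u} → u ∈ S → adj G u v ≡ true → u ∈ T) → deg G S v ≤ deg G T v
  deg-mono {S} {T} v S∩N⊆T = sum-map-mono (allFin n) term-mono
    where
    term-mono : ∀ u → (if lookup S u ∧ adj G u v then 1 else 0) ≤ (if lookup T u ∧ adj G u v then 1 else 0)
    term-mono u with lookup S u in u∈S | adj G u v in uv
    ... | false | _     = z≤n
    ... | true  | false = z≤n
    ... | true  | true  rewrite []=⇒lookup (S∩N⊆T (lookup⇒[]= u S u∈S) uv) = ≤-refl

  deg-mono-⊆ : ∀ {S T} v → S ⊆ T → deg G S v ≤ deg G T v
  deg-mono-⊆ v S⊆T = deg-mono v λ u∈S _ → S⊆T u∈S

  minDeg-⊆-remove : ∀ {k S T u} → T ⊆ S → MinDegAtLeast G k T → deg G S u < k → T ⊆ S - u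
  minDeg-⊆-remove T⊆S minDegT lowDeg {x} x∈T =
    x∈p∧x≢y⇒x∈p-y (T⊆S x∈T) λ { refl → <⇒≱ lowDeg (≤-trans (minDegT x x∈T) (deg-mono-⊆ x T⊆S)) }

  Run-preserves-minDeg : ∀ {d₁ H ms S} → Run G d₁ H ms → S ⊆ H → MinDegAtLeast G d₁ S →
                         S ⊆ finalH G H ms
  Run-preserves-minDeg done                 S⊆H _       = S⊆H
  Run-preserves-minDeg (move _ lowDeg run) S⊆H minDegS =
    Run-preserves-minDeg run (minDeg-⊆-remove S⊆H minDegS lowDeg) minDegS

  Run-keeps-kCore : ∀ {d₁ k ms v} → Run G d₁ ⊤ ms → d₁ ≤ k → InKCore G k v → v ∈ finalH G ⊤ ms
  Run-keeps-kCore run d₁≤k (S , (_ , minDegS , _) , v∈S) =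
    Run-preserves-minDeg run (λ _ → ∈⊤) (λ u u∈S → ≤-trans d₁≤k (minDegS u u∈S)) v∈S

  record Kernel (k : ℕ) (S : Subset n) : Set where
    field
      vertices : Subset n
      ⊆S       : vertices ⊆ S
      minDeg   : MinDegAtLeast G k vertices
      greatest : ∀ {T} → T ⊆ S → MinDegAtLeast G k T → T ⊆ vertices

  kernel : ∀ k S → Kernel k S
  kernel k S = peel S (<-wellFounded ∣ S ∣)
    where
    peel : ∀ S → Acc _<_ ∣ S ∣ → Kernel k S
    peel S (acc smaller) with any? (λ u → (u ∈? S) ×-dec (deg G S u <? k))
    ... | no noLow = record
      { vertices = S
      ; ⊆S       = λ x∈S → x∈S
      ; minDeg   = λ u u∈S → ≮⇒≥ λ low → noLow (u , u∈S , low)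
      ; greatest = λ T⊆S _ → T⊆S
      }
    ... | yes (u , u∈S , low) = record
      { vertices = vertices
      ; ⊆S       = λ x∈K → p─q⊆p S ⁅ u ⁆ (⊆S x∈K)
      ; minDeg   = minDeg
      ; greatest = λ T⊆S minDegT → greatest (minDeg-⊆-remove T⊆S minDegT low) minDegT
      }
      where open Kernel (peel (S - u) (smaller (x∈p⇒∣p-x∣<∣p∣ u∈S)))

  Reach-source∈ : ∀ {S a b} → Reach G S a b → a ∈ S
  Reach-source∈ (here a∈S)     = a∈S
  Reach-source∈ (step a∈S _ _) = a∈S

  Reach-snoc : ∀ {S a b c} → Reach G S a b → adj G b c ≡ true → c ∈ S → Reach G S a c
  Reach-snoc (here a∈S)      bc c∈S = step a∈S bc (here c∈S)
  Reach-snoc (step a∈S ab r) bc c∈S = step a∈S ab (Reach-snoc r bc c∈S)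

  Reach-reverse : ∀ {S a b} → Reach G S a b → Reach G S b a
  Reach-reverse (here a∈S)              = here a∈S
  Reach-reverse (step {a} {w} a∈S aw r) = Reach-snoc (Reach-reverse r) (trans (adj-sym G w a) aw) a∈S

  Reach-trans : ∀ {S a b c} → Reach G S a b → Reach G S b c → Reach G S a c
  Reach-trans (here _)        r′ = r′
  Reach-trans (step a∈S ab r) r′ = step a∈S ab (Reach-trans r r′)

  Reach-mono : ∀ {S T a b} → S ⊆ T → Reach G S a b → Reach G T a b
  Reach-mono S⊆T (here a∈S)      = here (S⊆T a∈S)
  Reach-mono S⊆T (step a∈S ab r) = step (S⊆T a∈S) ab (Reach-mono S⊆T r)

  record Component (P : Subset n) (v : Fin n) : Set where
    field
      vertices : Subset n
      ⊆P       : vertices ⊆ P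
      ∋v       : v ∈ vertices
      reach    : ∀ {u} → u ∈ vertices → Reach G vertices v u
      closed   : ∀ {w u} → w ∈ vertices → adj G w u ≡ true → u ∈ P → u ∈ vertices

  Reach-closed : ∀ {P T C a b} → (∀ {w u} → w ∈ C → adj G w u ≡ true → u ∈ P → u ∈ C) →
                 T ⊆ P → Reach G T a b → a ∈ C → b ∈ C
  Reach-closed closed T⊆P (here _)       a∈C = a∈C
  Reach-closed closed T⊆P (step _ aw r) a∈C = Reach-closed closed T⊆P r (closed a∈C aw (T⊆P (Reach-source∈ r)))

  Reach-extend : ∀ {R v w u x} → (∀ {y} → y ∈ R → Reach G R v y) → w ∈ R → adj G w u ≡ true →
                 x ∈ R ∪ ⁅ u ⁆ → Reach G (R ∪ ⁅ u ⁆) v x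
  Reach-extend {R} {u = u} reach w∈R wu x∈R′ with map₂ (x∈⁅y⁆⇒x≡y u) (x∈p∪q⁻ R ⁅ u ⁆ x∈R′)
  ... | inj₁ x∈R = Reach-mono (p⊆p∪q ⁅ u ⁆) (reach x∈R)
  ... | inj₂ refl = Reach-snoc (Reach-mono (p⊆p∪q ⁅ u ⁆) (reach w∈R)) wu x∈R′

  component : ∀ {P v} → v ∈ P → Component P v
  component {P} {v} v∈P = grow ⁅ v ⁆ (<-wellFounded _) ⁅v⁆⊆P (x∈⁅x⁆ v) reach-⁅v⁆
    where
    ⁅v⁆⊆P : ⁅ v ⁆ ⊆ P
    ⁅v⁆⊆P x∈⁅v⁆ with refl ← x∈⁅y⁆⇒x≡y v x∈⁅v⁆ = v∈P

    reach-⁅v⁆ : ∀ {u} → u ∈ ⁅ v ⁆ → Reach G ⁅ v ⁆ v u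
    reach-⁅v⁆ u∈⁅v⁆ with refl ← x∈⁅y⁆⇒x≡y v u∈⁅v⁆ = here u∈⁅v⁆

    grow : ∀ R → Acc _<_ (n ∸ ∣ R ∣) → R ⊆ P → v ∈ R → (∀ {u} → u ∈ R → Reach G R v u) → Component P v
    grow R (acc smaller) R⊆P v∈R reach
      with any? (λ u → ¬? (u ∈? R) ×-dec (u ∈? P) ×-dec any? (λ w → (w ∈? R) ×-dec (adj G w u ≟ᵇ true)))
    ... | no noExit = record { vertices = R ; ⊆P = R⊆P ; ∋v = v∈R ; reach = reach ; closed = closed }
      where
      closed : ∀ {w u} → w ∈ R → adj G w u ≡ true → u ∈ P → u ∈ R
      closed {w} {u} w∈R wu u∈P with u ∈? R
      ... | yes u∈R = u∈R
      ... | no  u∉R = contradiction (u , u∉R , u∈P , w , w∈R , wu) noExit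
    ... | yes (u , u∉R , u∈P , w , w∈R , wu) =
      grow (R ∪ ⁅ u ⁆) (smaller fewerOutside) R′⊆P (p⊆p∪q ⁅ u ⁆ v∈R) (Reach-extend reach w∈R wu)
      where
      fewerOutside : n ∸ ∣ R ∪ ⁅ u ⁆ ∣ < n ∸ ∣ R ∣
      fewerOutside = ∸-monoʳ-< (p⊂q⇒∣p∣<∣q∣ ((λ {x} → p⊆p∪q {p = R} ⁅ u ⁆) , u , q⊆p∪q R ⁅ u ⁆ (x∈⁅x⁆ u) , u∉R)) (∣p∣≤n (R ∪ ⁅ u ⁆))

      R′⊆P : R ∪ ⁅ u ⁆ ⊆ P
      R′⊆P x∈R′ with map₂ (x∈⁅y⁆⇒x≡y u) (x∈p∪q⁻ R ⁅ u ⁆ x∈R′)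
      ... | inj₁ x∈R  = R⊆P x∈R
      ... | inj₂ refl = u∈P

  component-isKCore : ∀ {k v} (K : Kernel k ⊤) (v∈K : v ∈ Kernel.vertices K) →
                      IsKCore G k (Component.vertices (component v∈K))
  component-isKCore {k} {v} K v∈K = connected , minDegC , maximal
    where
    open Component (component v∈K) renaming (vertices to C)

    connected : Connected G C
    connected a b a∈C b∈C = Reach-trans (Reach-reverse (reach a∈C)) (reach b∈C)

    minDegC : MinDegAtLeast G k C
    minDegC u u∈C = ≤-trans (Kernel.minDeg K u (⊆P u∈C))
                      (deg-mono u λ {x} x∈K xu → closed u∈C (trans (adj-sym G u x) xu) x∈K)

    maximal : ∀ T → C ⊆ T → Connected G T → MinDegAtLeast G k T → T ⊆ C
    maximal T C⊆T connectedT minDegT t∈T =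
      Reach-closed closed (Kernel.greatest K (λ _ → ∈⊤) minDegT) (connectedT v _ (C⊆T ∋v) t∈T) ∋v

  minDeg⇒inKCore : ∀ {k S v} → MinDegAtLeast G k S → v ∈ S → InKCore G k v
  minDeg⇒inKCore {k} minDegS v∈S =
    Component.vertices (component v∈K) , component-isKCore K v∈K , Component.∋v (component v∈K)
    where
    K = kernel k ⊤
    v∈K = Kernel.greatest K (λ _ → ∈⊤) minDegS v∈S

  inKCore? : ∀ k v → Dec (InKCore G k v)
  inKCore? k v with v ∈? Kernel.vertices (kernel k ⊤)
  ... | yes v∈K = yes (minDeg⇒inKCore (Kernel.minDeg (kernel k ⊤)) v∈K)
  ... | no  v∉K = no λ (S , (_ , minDegS , _) , v∈S) → v∉K (Kernel.greatest (kernel k ⊤) (λ _ → ∈⊤) minDegS v∈S)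

  inKCore⇒≤deg : ∀ {k v} → InKCore G k v → k ≤ deg G ⊤ v
  inKCore⇒≤deg {v = v} (S , (_ , minDegS , _) , v∈S) = ≤-trans (minDegS v v∈S) (deg-mono-⊆ {S} v λ _ → ∈⊤)

  coreNumber : ∀ v → ∃ (IsCoreNumber G v)
  coreNumber v = greatest-satisfying (λ k → inKCore? k v) (minDeg⇒inKCore {S = ⊤} (λ _ _ → z≤n) ∈⊤)
                   (deg G ⊤ v) (λ _ → inKCore⇒≤deg)

lemma5 : {n : ℕ} (G : Graph n) (d₁ d₂ : ℕ) (moves : List (Fin n))
         → Run G d₁ ⊤ moves
         → (∀ v → v ∈ finalH G ⊤ moves → d₂ ≤ deg G (finalH G ⊤ moves) v)
         → (∀ v → v ∈ finalH G ⊤ moves → ∃ λ c → IsCoreNumber G v c × d₂ ≤ c)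
           × (∀ v → v ∉ finalH G ⊤ moves → ∃ λ c → IsCoreNumber G v c × c < d₁)
lemma5 G d₁ d₂ moves run finalMinDeg = inH , inL
  where
  inH : ∀ v → v ∈ finalH G ⊤ moves → ∃ λ c → IsCoreNumber G v c × d₂ ≤ c
  inH v v∈H with coreNumber G v
  ... | c , isCore@(_ , maximal) = c , isCore , maximal d₂ (minDeg⇒inKCore G finalMinDeg v∈H)

  inL : ∀ v → v ∉ finalH G ⊤ moves → ∃ λ c → IsCoreNumber G v c × c < d₁
  inL v v∉H with coreNumber G v
  ... | c , isCore@(inCore , _) = c , isCore , ≰⇒> λ d₁≤c → v∉H (Run-keeps-kCore G run d₁≤c inCore)
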